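{- Let $s\in W_c$ and let $B$ be a formula. If $s$ is not maximal with respect to $B$, then there exists $t\in W_c$ such that $s\subsetneq t$, $t\not\models B$, and $t$ is maximal with respect to $B$.
   Context: Formulas over a countably infinite set $\mathbf{At}$ of atoms: $A::=p\mid (A\rightarrow A)\mid \top\mid\bot\mid (A\wedge A)\mid (A\vee A)\mid \square A\mid \lozenge A$; $\neg A$ abbreviates $A\rightarrow\bot$. $\mathbf{LIK4}$ is the least set of formulas that is closed under uniform substitution, contains the standard axioms of intuitionistic propositional logic, is closed under modus ponens, contains the axioms $\square p\wedge\square q\rightarrow\square(p\wedge q)$, $\lozenge(p\vee q)\rightarrow\lozenge p\vee\lozenge q$, $\square\top$, $\neg\lozenge\bot$, $\square p\rightarrow\square\square p$, $\lozenge\lozenge p\rightarrow\lozenge p$, $\square(p\vee q)\rightarrow\lozenge p\vee\square q$, $\lozenge(p\rightarrow q)\rightarrow(\square p\rightarrow\lozenge q)$, and is closed under the rules: from $p\rightarrow q$ infer $\square p\rightarrow\square q$; from $p\rightarrow q$ infer $\lozenge p\rightarrow\lozenge q$. A theory is a set of formulas containing $\mathbf{LIK4}$ and closed under modus ponens; proper if $\bot\notin$ it; a proper theory $s$ is prime if $A\vee B\in s$ implies $A\in s$ or $B\in s$. The canonical model $(W_c,\leq_c,R_c,V_c)$: $W_c$ is the set of prime theories, $s\leq_c t$ iff $s\subseteq t$, $sR_ct$ iff for all formulas $A$ ($\square A\in s\Rightarrow A\in t$) and ($A\in t\Rightarrow\lozenge A\in s$), $V_c(p)=\{s\in W_c: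 p\in s\}$. Satisfaction $s\models B$ in this model: $s\models p$ iff $s\in V_c(p)$; $s\models C\rightarrow D$ iff for all $t\supseteq s$ in $W_c$, $t\models C$ implies $t\models D$; $s\models\top$; $s\not\models\bot$; $\wedge,\vee$ pointwise; $s\models\square C$ iff $t\models C$ for all $t$ with $sR_ct$; $s\models\lozenge C$ iff $t\models C$ for some $t$ with $sR_ct$. $s\in W_c$ is maximal with respect to $B$ if for all $t\in W_c$ with $s\subsetneq t$, $t\models B$. -}

module Defs where

open import Level using (Level; Lift; 0ℓ) renaming (suc to lsuc)
open import Data.Nat using (ℕ)
open import Data.Empty using (⊥)
open import Data.Unit using (⊤)
open import Data.Product using (Σ; _×_)
open import Data.Sum using (_⊎_)
open import Relation.Nullary using (¬_)

infixr 5 _⇒_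
infixr 6 _∨'_
infixr 7 _∧'_
data Fm : Set where
  atom : ℕ → Fm
  _⇒_  : Fm → Fm → Fm
  ⊤'   : Fm
  ⊥'   : Fm
  _∧'_ : Fm → Fm → Fm
  _∨'_ : Fm → Fm → Fm
  □    : Fm → Fm
  ◇    : Fm → Fm

¬' : Fm → Fm
¬' A = A ⇒ ⊥'

sub : (ℕ → Fm) → Fm → Fm
sub σ (atom n) = σ n
sub σ (A ⇒ B)  = sub σ A ⇒ sub σ B
sub σ ⊤'       = ⊤'
sub σ ⊥'       = ⊥'
sub σ (A ∧' B) = sub σ A ∧' sub σ B
sub σ (A ∨' B) = sub σ A ∨' sub σ B
sub σ (□ A)    = □ (sub σ A)
sub σ (◇ A)    = ◇ (sub σ A)

p q r : Fm
p = atom 0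
q = atom 1
r = atom 2

data LIK4 : Fm → Set where
  ipc1  : LIK4 (p ⇒ q ⇒ p)
  ipc2  : LIK4 ((p ⇒ q ⇒ r) ⇒ (p ⇒ q) ⇒ p ⇒ r)
  ipc3  : LIK4 (p ∧' q ⇒ p)
  ipc4  : LIK4 (p ∧' q ⇒ q)
  ipc5  : LIK4 (p ⇒ q ⇒ p ∧' q)
  ipc6  : LIK4 (p ⇒ p ∨' q)
  ipc7  : LIK4 (q ⇒ p ∨' q)
  ipc8  : LIK4 ((p ⇒ r) ⇒ (q ⇒ r) ⇒ p ∨' q ⇒ r)
  ipc9  : LIK4 (⊥' ⇒ p)
  ipc10 : LIK4 ⊤'
  axK□  : LIK4 (□ p ∧' □ q ⇒ □ (p ∧' q))
  axK◇  : LIK4 (◇ (p ∨' q) ⇒ ◇ p ∨' ◇ q)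
  axN□  : LIK4 (□ ⊤')
  axN◇  : LIK4 (¬' (◇ ⊥'))
  ax4□  : LIK4 (□ p ⇒ □ (□ p))
  ax4◇  : LIK4 (◇ (◇ p) ⇒ ◇ p)
  axDP  : LIK4 (□ (p ∨' q) ⇒ ◇ p ∨' □ q)
  axFS  : LIK4 (◇ (p ⇒ q) ⇒ □ p ⇒ ◇ q)
  usub  : ∀ {A} (σ : ℕ → Fm) → LIK4 A → LIK4 (sub σ A)
  mp    : ∀ {A B} → LIK4 (A ⇒ B) → LIK4 A → LIK4 B
  mon□  : ∀ {A B} → LIK4 (A ⇒ B) → LIK4 (□ A ⇒ □ B)
  mon◇  : ∀ {A B} → LIK4 (A ⇒ B) → LIK4 (◇ A ⇒ ◇ B)

record IsTheory (S : Fm → Set) : Set where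
  field
    lik4 : ∀ {A} → LIK4 A → S A
    mpS  : ∀ {A B} → S (A ⇒ B) → S A → S B

-- W_c: prime theories (proper, prime)
record World : Set₁ where
  field
    set    : Fm → Set
    theory : IsTheory set
    proper : ¬ set ⊥'
    prime  : ∀ {A B} → set (A ∨' B) → set A ⊎ set B
open World public

_⊆_ : World → World → Set
s ⊆ t = ∀ {A} → set s A → set t A

_⊊_ : World → World → Set
s ⊊ t = s ⊆ t × ¬ (t ⊆ s)

Rc : World → World → Set
Rc s t = (∀ {A} → set s (□ A) → set t A) × (∀ {A} → set t A → set s (◇ A))

infix 4 _⊨_
_⊨_ : World → Fm → Set₁
s ⊨ atom n   = Lift (lsuc 0ℓ) (set s (atom n))
s ⊨ (A ⇒ B)  = ∀ t → s ⊆ t → t ⊨ A → t ⊨ B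
s ⊨ ⊤'       = Lift (lsuc 0ℓ) ⊤
s ⊨ ⊥'       = Lift (lsuc 0ℓ) ⊥
s ⊨ (A ∧' B) = (s ⊨ A) × (s ⊨ B)
s ⊨ (A ∨' B) = (s ⊨ A) ⊎ (s ⊨ B)
s ⊨ □ A      = ∀ t → Rc s t → t ⊨ A
s ⊨ ◇ A      = Σ World (λ t → Rc s t × (t ⊨ A))

Maximal : World → Fm → Set₁
Maximal s B = ∀ t → s ⊊ t → t ⊨ B

-- Classically, since s is not maximal there is a prime theory u ⊋ s refuting B, so
-- B ∉ u by the truth lemma.  Extend u, by a Lindenbaum construction, to a prime
-- theory t with B ∉ t that is saturated: A → B ∈ t for every A ∉ t.  Any prime
-- theory strictly above t contains some A ∉ t, hence A → B, hence B.  The truth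
-- lemma, whose □, ◇ and → cases are themselves Lindenbaum constructions avoiding
-- suitable disjunction-closed sets, turns these memberships into satisfaction.
module Submission where

open import Defs
open import Level using (0ℓ; lift; lower) renaming (suc to lsuc)
open import Axiom.ExcludedMiddle using (ExcludedMiddle)
open import Axiom.DoubleNegationElimination using (DoubleNegationElimination; em⇒dne)
open import Data.Product using (Σ; Σ-syntax; ∃-syntax; _×_; _,_; proj₁; proj₂)
open import Relation.Nullary using (¬_; Dec; yes; no)
open import Relation.Nullary.Decidable using (map′)
open import Relation.Unary using (Pred; ∅; ｛_｝; _∪_) renaming (_⊆_ to _⊆ₚ_)
open import Data.Nat using (ℕ; zero; suc; _≤′_; ≤′-refl; ≤′-step; _⊔_)
open import Data.Nat.Properties using (m≤m⊔n; m≤n⊔m; ≤⇒≤′)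
open import Data.Empty using (⊥-elim)
open import Data.Unit using (tt)
open import Data.Sum using (_⊎_; inj₁; inj₂; [_,_]′)
open import Data.List using (List; []; _∷_; _++_; map; concat; foldl; cartesianProductWith)
open import Data.List.Relation.Unary.Any using (here; there)
open import Data.List.Membership.Propositional using (_∈_)
open import Data.List.Membership.Propositional.Properties
  using (∈-++⁺ˡ; ∈-++⁺ʳ; ∈-map⁺; ∈-concat⁺′; ∈-cartesianProductWith⁺)
open import Function using (id; _∘_)
open import Relation.Binary.PropositionalEquality using (refl)

-- Hilbert-style derivations of LIK4 from hypotheses

infix 3 _⊢_
infixl 8 _·_

data _⊢_ (Γ : Pred Fm 0ℓ) : Fm → Set where
  ax  : ∀ {A} → LIK4 A → Γ ⊢ A
  hyp : ∀ {A} → Γ A → Γ ⊢ A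
  _·_ : ∀ {A B} → Γ ⊢ A ⇒ B → Γ ⊢ A → Γ ⊢ B

∅⊢⇒LIK4 : ∀ {A} → ∅ ⊢ A → LIK4 A
∅⊢⇒LIK4 (ax a)  = a
∅⊢⇒LIK4 (d · e) = mp (∅⊢⇒LIK4 d) (∅⊢⇒LIK4 e)

⊢-mono : ∀ {Γ Γ′ A} → Γ ⊆ₚ Γ′ → Γ ⊢ A → Γ′ ⊢ A
⊢-mono Γ⊆Γ′ (ax a)  = ax a
⊢-mono Γ⊆Γ′ (hyp h) = hyp (Γ⊆Γ′ h)
⊢-mono Γ⊆Γ′ (d · e) = ⊢-mono Γ⊆Γ′ d · ⊢-mono Γ⊆Γ′ e

⊢⇒∈ : ∀ {S A} → IsTheory S → S ⊢ A → S A
⊢⇒∈ S-theory (ax a)  = IsTheory.lik4 S-theory a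
⊢⇒∈ S-theory (hyp h) = h
⊢⇒∈ S-theory (d · e) = IsTheory.mpS S-theory (⊢⇒∈ S-theory d) (⊢⇒∈ S-theory e)

pqr : Fm → Fm → Fm → ℕ → Fm
pqr A B C 0 = A
pqr A B C 1 = B
pqr A B C _ = C

module _ {Γ : Pred Fm 0ℓ} where

  K : ∀ {A B} → Γ ⊢ A ⇒ B ⇒ A
  K {A} {B} = ax (usub (pqr A B ⊤') ipc1)

  S : ∀ {A B C} → Γ ⊢ (A ⇒ B ⇒ C) ⇒ (A ⇒ B) ⇒ A ⇒ C
  S {A} {B} {C} = ax (usub (pqr A B C) ipc2)

  I : ∀ {A} → Γ ⊢ A ⇒ A
  I {A} = S · K · K {A} {A}

  ∧-intro : ∀ {A B} → Γ ⊢ A → Γ ⊢ B → Γ ⊢ A ∧' B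
  ∧-intro {A} {B} a b = ax (usub (pqr A B ⊤') ipc5) · a · b

  ∧-elimˡ : ∀ {A B} → Γ ⊢ A ∧' B → Γ ⊢ A
  ∧-elimˡ {A} {B} d = ax (usub (pqr A B ⊤') ipc3) · d

  ∧-elimʳ : ∀ {A B} → Γ ⊢ A ∧' B → Γ ⊢ B
  ∧-elimʳ {A} {B} d = ax (usub (pqr A B ⊤') ipc4) · d

  ∨-introˡ : ∀ {A B} → Γ ⊢ A ⇒ A ∨' B
  ∨-introˡ {A} {B} = ax (usub (pqr A B ⊤') ipc6)

  ∨-introʳ : ∀ {A B} → Γ ⊢ B ⇒ A ∨' B
  ∨-introʳ {A} {B} = ax (usub (pqr A B ⊤') ipc7)

  ∨-case : ∀ {A B C} → Γ ⊢ A ⇒ C → Γ ⊢ B ⇒ C → Γ ⊢ A ∨' B ⇒ C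
  ∨-case {A} {B} {C} f g = ax (usub (pqr A B C) ipc8) · f · g

  ex-falso : ∀ {A} → Γ ⊢ ⊥' → Γ ⊢ A
  ex-falso {A} d = ax (usub (pqr A ⊤' ⊤') ipc9) · d

deduction : ∀ {Γ A C} → Γ ∪ ｛ A ｝ ⊢ C → Γ ⊢ A ⇒ C
deduction (ax a)           = K · ax a
deduction (hyp (inj₁ h))   = K · hyp h
deduction (hyp (inj₂ refl)) = I
deduction (d · e)          = S · deduction d · deduction e

weaken : ∀ {Γ A C} → Γ ⊢ C → Γ ∪ ｛ A ｝ ⊢ C
weaken = ⊢-mono inj₁

assumption : ∀ {Γ A} → Γ ∪ ｛ A ｝ ⊢ A
assumption = hyp (inj₂ refl)

infixr 9 _⨾_

_⨾_ : ∀ {Γ A B C} → Γ ⊢ A ⇒ B → Γ ⊢ B ⇒ C → Γ ⊢ A ⇒ C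
f ⨾ g = deduction (weaken g · (weaken f · assumption))

∨-map : ∀ {Γ A A′ B B′} → Γ ⊢ A ⇒ A′ → Γ ⊢ B ⇒ B′ → Γ ⊢ A ∨' B ⇒ A′ ∨' B′
∨-map f g = ∨-case (f ⨾ ∨-introˡ) (g ⨾ ∨-introʳ)

-- Enumerating formulas

Chain : (ℕ → Pred Fm 0ℓ) → Set
Chain F = ∀ k → F k ⊆ₚ F (suc k)

chain-⊆ : ∀ {F m n} → Chain F → m ≤′ n → F m ⊆ₚ F n
chain-⊆ F-chain ≤′-refl         = id
chain-⊆ F-chain (≤′-step m≤′n) = F-chain _ ∘ chain-⊆ F-chain m≤′n

chain-⊔ : ∀ {F A B} → Chain F → ∃[ m ] F m A → ∃[ n ] F n B → ∃[ k ] F k A × F k B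
chain-⊔ F-chain (m , a) (n , b) =
  m ⊔ n , chain-⊆ F-chain (≤⇒≤′ (m≤m⊔n m n)) a , chain-⊆ F-chain (≤⇒≤′ (m≤n⊔m m n)) b

layer : ℕ → List Fm → List (List Fm)
layer k Φ = (⊤' ∷ ⊥' ∷ atom k ∷ []) ∷ map □ Φ ∷ map ◇ Φ
          ∷ cartesianProductWith _⇒_ Φ Φ ∷ cartesianProductWith _∧'_ Φ Φ
          ∷ cartesianProductWith _∨'_ Φ Φ ∷ []

formulas : ℕ → List Fm
formulas zero    = []
formulas (suc k) = formulas k ++ concat (layer k (formulas k))

formulas-chain : Chain (λ k A → A ∈ formulas k)
formulas-chain k = ∈-++⁺ˡ

∈-layer : ∀ {k A Φs} → Φs ∈ layer k (formulas k) → A ∈ Φs → A ∈ formulas (suc k)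
∈-layer {k} Φs∈layer A∈Φs = ∈-++⁺ʳ (formulas k) (∈-concat⁺′ A∈Φs Φs∈layer)

∈-formulas : ∀ A → ∃[ k ] A ∈ formulas k
∈-formulas (atom n) = suc n , ∈-layer (here refl) (there (there (here refl)))
∈-formulas ⊤'       = 1 , ∈-layer {0} (here refl) (here refl)
∈-formulas ⊥'       = 1 , ∈-layer {0} (here refl) (there (here refl))
∈-formulas (□ A) with k , a ← ∈-formulas A =
  suc k , ∈-layer (there (here refl)) (∈-map⁺ □ a)
∈-formulas (◇ A) with k , a ← ∈-formulas A =
  suc k , ∈-layer (there (there (here refl))) (∈-map⁺ ◇ a)
∈-formulas (A ⇒ B) with k , a , b ← chain-⊔ formulas-chain (∈-formulas A) (∈-formulas B) =
  suc k , ∈-layer (there (there (there (here refl)))) (∈-cartesianProductWith⁺ _⇒_ a b)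
∈-formulas (A ∧' B) with k , a , b ← chain-⊔ formulas-chain (∈-formulas A) (∈-formulas B) =
  suc k , ∈-layer (there (there (there (there (here refl))))) (∈-cartesianProductWith⁺ _∧'_ a b)
∈-formulas (A ∨' B) with k , a , b ← chain-⊔ formulas-chain (∈-formulas A) (∈-formulas B) =
  suc k , ∈-layer (there (there (there (there (there (here refl))))))
                  (∈-cartesianProductWith⁺ _∨'_ a b)

-- The Lindenbaum lemma

record IsJoinClosed (Δ : Pred Fm 0ℓ) : Set where
  field
    inhabitant : Fm
    inhabited  : Δ inhabitant
    ∨-closed   : ∀ {D E} → Δ D → Δ E → Δ (D ∨' E)

Avoids : Pred Fm 0ℓ → Pred Fm 0ℓ → Set
Avoids Δ Γ = ∀ {D} → Δ D → ¬ (Γ ⊢ D)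

Meets : Pred Fm 0ℓ → Pred Fm 0ℓ → Set
Meets Δ Γ = Σ[ D ∈ Fm ] Δ D × Γ ⊢ D

Decides : Pred Fm 0ℓ → Pred Fm 0ℓ → Fm → Set
Decides Δ Γ A = Γ A ⊎ Σ[ D ∈ Fm ] Δ D × Γ ⊢ A ⇒ D

decides-mono : ∀ {Δ Γ Γ′ A} → Γ ⊆ₚ Γ′ → Decides Δ Γ A → Decides Δ Γ′ A
decides-mono Γ⊆Γ′ (inj₁ A∈Γ)         = inj₁ (Γ⊆Γ′ A∈Γ)
decides-mono Γ⊆Γ′ (inj₂ (D , δ , d)) = inj₂ (D , δ , ⊢-mono Γ⊆Γ′ d)

record PrimeExtension (Γ Δ : Pred Fm 0ℓ) : Set₁ where
  field
    world     : World
    extends   : Γ ⊆ₚ set world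
    avoids    : ∀ {D} → Δ D → ¬ set world D
    saturated : ∀ {A} → ¬ set world A → Σ[ D ∈ Fm ] Δ D × set world (A ⇒ D)

-- Formulas are added one by one along the enumeration unless that lets Δ be derived.
module Lindenbaum (em : ExcludedMiddle 0ℓ) {Γ Δ : Pred Fm 0ℓ}
                  (Δ-joins : IsJoinClosed Δ) (Γ-avoids : Avoids Δ Γ) where
  open IsJoinClosed Δ-joins

  extend : (T : Pred Fm 0ℓ) (A : Fm) → Dec (Meets Δ (T ∪ ｛ A ｝)) → Pred Fm 0ℓ
  extend T A (yes _) = T
  extend T A (no _)  = T ∪ ｛ A ｝

  ⊆-extend : ∀ T A d → T ⊆ₚ extend T A d
  ⊆-extend T A (yes _) = id
  ⊆-extend T A (no _)  = inj₁

  avoids-extend : ∀ T A d → Avoids Δ T → Avoids Δ (extend T A d)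
  avoids-extend T A (yes _)     T-avoids = T-avoids
  avoids-extend T A (no ¬meets) _ δ d    = ¬meets (_ , δ , d)

  decides-extend : ∀ T A d → Decides Δ (extend T A d) A
  decides-extend T A (yes (D , δ , d)) = inj₂ (D , δ , deduction d)
  decides-extend T A (no _)            = inj₁ (inj₂ refl)

  step : Pred Fm 0ℓ → Fm → Pred Fm 0ℓ
  step T A = extend T A em

  ⊆-steps : ∀ T As → T ⊆ₚ foldl step T As
  ⊆-steps T []       = id
  ⊆-steps T (A ∷ As) = ⊆-steps (step T A) As ∘ ⊆-extend T A em

  avoids-steps : ∀ T As → Avoids Δ T → Avoids Δ (foldl step T As)
  avoids-steps T []       T-avoids = T-avoids
  avoids-steps T (A ∷ As) T-avoids = avoids-steps (step T A) As (avoids-extend T A em T-avoids)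

  decides-steps : ∀ T As {A} → A ∈ As → Decides Δ (foldl step T As) A
  decides-steps T (A ∷ As) (here refl) =
    decides-mono (⊆-steps (step T A) As) (decides-extend T A em)
  decides-steps T (B ∷ As) (there A∈As) = decides-steps (step T B) As A∈As

  stage : ℕ → Pred Fm 0ℓ
  stage zero    = Γ
  stage (suc k) = foldl step (stage k) (formulas k)

  avoids-stage : ∀ k → Avoids Δ (stage k)
  avoids-stage zero    = Γ-avoids
  avoids-stage (suc k) = avoids-steps (stage k) (formulas k) (avoids-stage k)

  derivable-chain : Chain (λ k → stage k ⊢_)
  derivable-chain k = ⊢-mono (⊆-steps (stage k) (formulas k))

  limit : Pred Fm 0ℓ
  limit A = ∃[ k ] stage k ⊢ A

  limit-theory : IsTheory limit
  limit-theory = record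
    { lik4 = λ a → 0 , ax a
    ; mpS  = λ d e → let k , d′ , e′ = chain-⊔ derivable-chain d e in k , d′ · e′
    }

  limit-avoids : ∀ {D} → Δ D → ¬ limit D
  limit-avoids δ (k , d) = avoids-stage k δ d

  limit-saturated : ∀ {A} → ¬ limit A → Σ[ D ∈ Fm ] Δ D × limit (A ⇒ D)
  limit-saturated {A} A∉limit with k , A∈formulas ← ∈-formulas A
    with decides-steps (stage k) (formulas k) A∈formulas
  ... | inj₁ A∈stage      = ⊥-elim (A∉limit (suc k , hyp A∈stage))
  ... | inj₂ (D , δ , d) = D , δ , suc k , d

  limit-prime : ∀ {A B} → limit (A ∨' B) → limit A ⊎ limit B
  limit-prime {A} {B} A∨B∈limit with em {limit A} | em {limit B}
  ... | yes A∈limit | _           = inj₁ A∈limit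
  ... | no _        | yes B∈limit = inj₂ B∈limit
  ... | no A∉limit  | no B∉limit
    with D , δ , A⇒D ← limit-saturated A∉limit | E , ε , B⇒E ← limit-saturated B∉limit =
    ⊥-elim (limit-avoids (∨-closed δ ε) (⊢⇒∈ limit-theory
      (∨-map (hyp A⇒D) (hyp B⇒E) · hyp A∨B∈limit)))

  extension : PrimeExtension Γ Δ
  extension = record
    { world = record
      { set    = limit
      ; theory = limit-theory
      ; proper = λ (k , d) → avoids-stage k inhabited (ex-falso d)
      ; prime  = limit-prime
      }
    ; extends   = λ A∈Γ → 0 , hyp A∈Γ
    ; avoids    = limit-avoids
    ; saturated = limit-saturated
    }

lindenbaum : ExcludedMiddle 0ℓ → ∀ {Γ Δ} → IsJoinClosed Δ → Avoids Δ Γ → PrimeExtension Γ Δ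
lindenbaum em Δ-joins Γ-avoids = Lindenbaum.extension em Δ-joins Γ-avoids

↓ : Fm → Pred Fm 0ℓ
↓ B D = LIK4 (D ⇒ B)

↓-joinClosed : ∀ B → IsJoinClosed (↓ B)
↓-joinClosed B = record
  { inhabitant = B
  ; inhabited  = ∅⊢⇒LIK4 I
  ; ∨-closed   = λ D⇒B E⇒B → ∅⊢⇒LIK4 (∨-case (ax D⇒B) (ax E⇒B))
  }

extension-avoiding : ExcludedMiddle 0ℓ → ∀ {Γ} B → ¬ (Γ ⊢ B) → PrimeExtension Γ (↓ B)
extension-avoiding em B Γ⊬B =
  lindenbaum em (↓-joinClosed B) (λ D⇒B Γ⊢D → Γ⊬B (ax D⇒B · Γ⊢D))

∈-closed : ∀ w {A} → set w ⊢ A → set w A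
∈-closed w = ⊢⇒∈ (theory w)

∈-LIK4 : ∀ w {A} → LIK4 A → set w A
∈-LIK4 w = IsTheory.lik4 (theory w)

∈-mp : ∀ w {A B} → set w (A ⇒ B) → set w A → set w B
∈-mp w = IsTheory.mpS (theory w)

⊊-⊆-trans : ∀ {s u t} → s ⊊ u → u ⊆ t → s ⊊ t
⊊-⊆-trans (s⊆u , u⊈s) u⊆t = u⊆t ∘ s⊆u , λ t⊆s → u⊈s (t⊆s ∘ u⊆t)

boxed : World → Pred Fm 0ℓ
boxed w A = set w (□ A)

-- necessitation and K make boxed w closed under derivability
boxed-closed : ∀ w {A} → boxed w ⊢ A → set w (□ A)
boxed-closed w {A} (ax a) = ∈-closed w (ax (mon□ (∅⊢⇒LIK4 (K · ax a))) · ax axN□)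
boxed-closed w (hyp h) = h
boxed-closed w (_·_ {A} {B} d e) =
  ∈-closed w (ax (mon□ (∅⊢⇒LIK4 (deduction (∧-elimˡ assumption · ∧-elimʳ assumption))))
              · (ax (usub (pqr (A ⇒ B) A ⊤') axK□)
                 · ∧-intro (hyp (boxed-closed w d)) (hyp (boxed-closed w e))))

◇⊥∉ : ∀ w → ¬ set w (◇ ⊥')
◇⊥∉ w ◇⊥∈w = proper w (∈-mp w (∈-LIK4 w axN◇) ◇⊥∈w)

◇-prime : ∀ w {A B} → set w (◇ (A ∨' B)) → set w (◇ A) ⊎ set w (◇ B)
◇-prime w {A} {B} ◇A∨B∈w = prime w (∈-closed w (ax (usub (pqr A B ⊤') axK◇) · hyp ◇A∨B∈w))

□-∨-split : ∀ w {A B} → set w (□ (A ∨' B)) → set w (◇ A) ⊎ set w (□ B)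
□-∨-split w {A} {B} □A∨B∈w = prime w (∈-closed w (ax (usub (pqr A B ⊤') axDP) · hyp □A∨B∈w))

◇-□-mp : ∀ w {A B} → set w (◇ A) → set w (□ (A ⇒ B)) → set w (◇ B)
◇-□-mp w {A} {B} ◇A∈w □A⇒B∈w =
  ∈-closed w (ax (usub (pqr (A ⇒ B) B ⊤') axFS)
              · (ax (mon◇ (∅⊢⇒LIK4 (deduction (deduction (assumption · weaken assumption)))))
                 · hyp ◇A∈w)
              · hyp □A⇒B∈w)

◇∉-joinClosed : ∀ w → IsJoinClosed (λ D → ¬ set w (◇ D))
◇∉-joinClosed w = record
  { inhabitant = ⊥'
  ; inhabited  = ◇⊥∉ w
  ; ∨-closed   = λ ◇D∉w ◇E∉w ◇D∨E∈w → [ ◇D∉w , ◇E∉w ]′ (◇-prime w ◇D∨E∈w)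
  }

-- The canonical model

module Canonical (em : ExcludedMiddle 0ℓ) where

  dne : DoubleNegationElimination 0ℓ
  dne = em⇒dne em

  successor : ∀ w {Γ Δ} → boxed w ⊆ₚ Γ → (∀ {X} → ¬ set w (◇ X) → Δ X) →
              (E : PrimeExtension Γ Δ) → Rc w (PrimeExtension.world E)
  successor w boxed⊆Γ ◇∉⇒Δ E =
    extends ∘ boxed⊆Γ , λ X∈t → dne λ ◇X∉w → avoids (◇∉⇒Δ ◇X∉w) X∈t
    where open PrimeExtension E

  ⇒-witness : ∀ w {A B} → ¬ set w (A ⇒ B) → Σ[ t ∈ World ] w ⊆ t × set t A × ¬ set t B
  ⇒-witness w {A} {B} A⇒B∉w =
    world , extends ∘ inj₁ , extends (inj₂ refl) , avoids (∅⊢⇒LIK4 I)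
    where open PrimeExtension (extension-avoiding em B (A⇒B∉w ∘ ∈-closed w ∘ deduction))

  ◇-witness : ∀ w {A} → set w (◇ A) → Σ[ t ∈ World ] Rc w t × set t A
  ◇-witness w {A} ◇A∈w = world , successor w inj₁ id E , extends (inj₂ refl)
    where
    E = lindenbaum em (◇∉-joinClosed w)
          (λ ◇D∉w d → ◇D∉w (◇-□-mp w ◇A∈w (boxed-closed w (deduction d))))
    open PrimeExtension E

  -- A itself is the instance C = ⊥'
  ◇∉∨ : World → Fm → Pred Fm 0ℓ
  ◇∉∨ w A D = Σ[ C ∈ Fm ] ¬ set w (◇ C) × LIK4 (D ⇒ C ∨' A)

  ◇∉∨-joinClosed : ∀ w A → IsJoinClosed (◇∉∨ w A)
  ◇∉∨-joinClosed w A = record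
    { inhabitant = A
    ; inhabited  = ⊥' , ◇⊥∉ w , ∅⊢⇒LIK4 ∨-introʳ
    ; ∨-closed   = λ (C , ◇C∉w , D⇒C∨A) (C′ , ◇C′∉w , E⇒C′∨A) →
        C ∨' C′ , IsJoinClosed.∨-closed (◇∉-joinClosed w) ◇C∉w ◇C′∉w ,
        ∅⊢⇒LIK4 (∨-case (ax D⇒C∨A ⨾ ∨-map ∨-introˡ I) (ax E⇒C′∨A ⨾ ∨-map ∨-introʳ I))
    }

  □-witness : ∀ w {A} → ¬ set w (□ A) → Σ[ t ∈ World ] Rc w t × ¬ set t A
  □-witness w {A} □A∉w =
    world , successor w id (λ {X} ◇X∉w → X , ◇X∉w , ∅⊢⇒LIK4 ∨-introˡ) E ,
    avoids (IsJoinClosed.inhabited (◇∉∨-joinClosed w A))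
    where
    boxed-avoids : Avoids (◇∉∨ w A) (boxed w)
    boxed-avoids (C , ◇C∉w , D⇒C∨A) d with □-∨-split w (boxed-closed w (ax D⇒C∨A · d))
    ... | inj₁ ◇C∈w = ◇C∉w ◇C∈w
    ... | inj₂ □A∈w = □A∉w □A∈w
    E = lindenbaum em (◇∉∨-joinClosed w A) boxed-avoids
    open PrimeExtension E

  mutual
    ∈⇒⊨ : ∀ A w → set w A → w ⊨ A
    ∈⇒⊨ (atom n) w A∈w = lift A∈w
    ∈⇒⊨ ⊤'       w _   = lift tt
    ∈⇒⊨ ⊥'       w ⊥∈w = ⊥-elim (proper w ⊥∈w)
    ∈⇒⊨ (A ∧' B) w A∧B∈w =
      ∈⇒⊨ A w (∈-closed w (∧-elimˡ (hyp A∧B∈w))) , ∈⇒⊨ B w (∈-closed w (∧-elimʳ (hyp A∧B∈w)))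
    ∈⇒⊨ (A ∨' B) w A∨B∈w with prime w A∨B∈w
    ... | inj₁ A∈w = inj₁ (∈⇒⊨ A w A∈w)
    ... | inj₂ B∈w = inj₂ (∈⇒⊨ B w B∈w)
    ∈⇒⊨ (A ⇒ B) w A⇒B∈w t w⊆t t⊨A = ∈⇒⊨ B t (∈-mp t (w⊆t A⇒B∈w) (⊨⇒∈ A t t⊨A))
    ∈⇒⊨ (□ A) w □A∈w t wRt = ∈⇒⊨ A t (proj₁ wRt □A∈w)
    ∈⇒⊨ (◇ A) w ◇A∈w with t , wRt , A∈t ← ◇-witness w ◇A∈w = t , wRt , ∈⇒⊨ A t A∈t

    ⊨⇒∈ : ∀ A w → w ⊨ A → set w A
    ⊨⇒∈ (atom n) w w⊨A = lower w⊨A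
    ⊨⇒∈ ⊤'       w _   = ∈-LIK4 w ipc10
    ⊨⇒∈ (A ∧' B) w (w⊨A , w⊨B) = ∈-closed w (∧-intro (hyp (⊨⇒∈ A w w⊨A)) (hyp (⊨⇒∈ B w w⊨B)))
    ⊨⇒∈ (A ∨' B) w (inj₁ w⊨A) = ∈-closed w (∨-introˡ · hyp (⊨⇒∈ A w w⊨A))
    ⊨⇒∈ (A ∨' B) w (inj₂ w⊨B) = ∈-closed w (∨-introʳ · hyp (⊨⇒∈ B w w⊨B))
    ⊨⇒∈ (A ⇒ B) w w⊨A⇒B = dne λ A⇒B∉w →
      let t , w⊆t , A∈t , B∉t = ⇒-witness w A⇒B∉w
      in B∉t (⊨⇒∈ B t (w⊨A⇒B t w⊆t (∈⇒⊨ A t A∈t)))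
    ⊨⇒∈ (□ A) w w⊨□A = dne λ □A∉w →
      let t , wRt , A∉t = □-witness w □A∉w
      in A∉t (⊨⇒∈ A t (w⊨□A t wRt))
    ⊨⇒∈ (◇ A) w (t , wRt , t⊨A) = proj₂ wRt (⊨⇒∈ A t t⊨A)

  ⊈⇒∃∉ : ∀ {w t} → ¬ (w ⊆ t) → Σ[ A ∈ Fm ] set w A × ¬ set t A
  ⊈⇒∃∉ w⊈t = dne λ no-witness →
    w⊈t λ {A} A∈w → dne λ A∉t → no-witness (A , A∈w , A∉t)

  maximal-extension : ∀ u {B} → ¬ set u B →
    Σ[ t ∈ World ] u ⊆ t × ¬ set t B × (∀ w → t ⊊ w → set w B)
  maximal-extension u {B} B∉u = world , extends , avoids (∅⊢⇒LIK4 I) , contains-B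
    where
    open PrimeExtension (extension-avoiding em B (B∉u ∘ ∈-closed u))
    contains-B : ∀ w → world ⊊ w → set w B
    contains-B w (t⊆w , w⊈t) with A , A∈w , A∉t ← ⊈⇒∃∉ {w} {world} w⊈t
      with D , D⇒B , A⇒D∈t ← saturated A∉t =
      ∈-mp w (∈-LIK4 w D⇒B) (∈-mp w (t⊆w A⇒D∈t) A∈w)

¬Maximal⇒counterexample : DoubleNegationElimination (lsuc 0ℓ) → ∀ {s B} → ¬ Maximal s B →
                          Σ[ u ∈ World ] s ⊊ u × ¬ (u ⊨ B)
¬Maximal⇒counterexample dne s-not-maximal = dne λ none →
  s-not-maximal λ u s⊊u → dne λ u⊭B → none (u , s⊊u , u⊭B)

lemma20 : ExcludedMiddle (lsuc 0ℓ) → (s : World) (B : Fm) → ¬ Maximal s B →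
    Σ World (λ t → (s ⊊ t) × (¬ (t ⊨ B)) × Maximal t B)
lemma20 em s B s-not-maximal =
  let u , s⊊u , u⊭B = ¬Maximal⇒counterexample (em⇒dne em) {s} {B} s-not-maximal
      t , u⊆t , B∉t , t-maximal = maximal-extension u (u⊭B ∘ ∈⇒⊨ B u)
  in t , ⊊-⊆-trans {s} {u} {t} s⊊u u⊆t , B∉t ∘ ⊨⇒∈ B t , λ w t⊊w → ∈⇒⊨ B w (t-maximal w t⊊w)
  where open Canonical (map′ lower lift em)
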